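{- Let $X$ be a finite set and let $\tau$ be a non-empty subset of $\binom{X}{3}$. Then $\tau$ is phylogenetically flexible if and only if $\tau$ is thin.
   Context: For a non-empty $\tau\subseteq\binom{X}{r}$ ($r\ge 2$), let $L(\tau)=\bigcup_{s\in\tau}s$ and define the excess ${\rm exc}(\tau)=|L(\tau)|-|\tau|-(r-1)$. Then $\tau$ is called thin if ${\rm exc}(\tau')\ge 0$ for every non-empty $\tau'\subseteq\tau$; for $r=3$ this means $|L(\tau')|\ge|\tau'|+2$ for all non-empty $\tau'\subseteq\tau$. A rooted phylogenetic tree is a rooted tree whose leaves (vertices of out-degree 0) are labelled, whose non-leaf vertices are unlabelled and have out-degree at least 2; it is a rooted phylogenetic $X$-tree if its leaf set is $X$. A rooted triple $ab|c$ is the rooted binary phylogenetic tree on leaf set $\{a,b,c\}$ in which $c$ is adjacent to the root (so $\{a,b\}$ is a cherry). A rooted phylogenetic $X$-tree $T$ displays $ab|c$ if some subdivision of $ab|c$ is a subgraph of $T$. A set $R$ of rooted triples with leaves in $X$ is compatible if some rooted phylogenetic $X$-tree displays every triple in $R$. For a set $R$ of rooted triples, $\|R\|$ denotes the collection of their leaf sets. A non-empty $\tau\subseteq\binom{X}{3}$ is phylogenetically flexible if, for every choice of one rooted triple with leaf set $s$ for each $s\in\tau$, the resulting set $R$ of rooted triples (so $\|R\|=\tau$) is compatible. -}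

module Defs where

open import Data.Nat using (ℕ; suc; _+_; _≤_)
open import Data.Integer as ℤ using (ℤ; +_; _-_)
open import Data.Fin using (Fin)
open import Data.Fin.Subset using (Subset; ∣_∣; _∪_; ⁅_⁆; ⊥)
open import Data.List using (List; []; length; foldr)
open import Data.List.Relation.Unary.All using (All)
open import Data.List.Relation.Unary.Unique.Propositional using (Unique)
open import Data.List.Relation.Binary.Sublist.Propositional using (_⊆_)
open import Data.Product using (Σ; ∃; _×_)
open import Relation.Binary.PropositionalEquality using (_≡_; _≢_)

-- Throughout, the finite set X is Fin n.

record Collection3 (n : ℕ) : Set where
  field
    sets    : List (Subset n)
    unique  : Unique sets
    allSize : All (λ s → ∣ s ∣ ≡ 3) sets

L : ∀ {n} → List (Subset n) → Subset n
L = foldr _∪_ ⊥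

-- excess for r = 3: exc(τ) = |L(τ)| - |τ| - (3 - 1)
exc : ∀ {n} → List (Subset n) → ℤ
exc τ = + ∣ L τ ∣ - + length τ - + 2

-- τ is thin: exc(τ') ≥ 0 for every non-empty τ' ⊆ τ.
-- Sub-collections of a duplicate-free list are exactly its sublists.
Thin : ∀ {n} → List (Subset n) → Set
Thin τ = ∀ τ' → τ' ⊆ τ → τ' ≢ [] → + 0 ℤ.≤ exc τ'

data Tree (n : ℕ) : Set where
  leaf : Fin n → Tree n
  node : ∀ {k} → (Fin (suc (suc k)) → Tree n) → Tree n

data Pos {n : ℕ} : Tree n → Fin n → Set where
  here  : ∀ {x} → Pos (leaf x) x
  there : ∀ {k} {cs : Fin (suc (suc k)) → Tree n} {x} (i : Fin (suc (suc k))) →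
          Pos (cs i) x → Pos (node cs) x

-- T is a rooted phylogenetic X-tree: its leaf labelling is a bijection onto X
-- (every x ∈ X labels exactly one leaf).
IsXTree : ∀ {n} → Tree n → Set
IsXTree {n} T = (x : Fin n) → Pos T x × ((p q : Pos T x) → p ≡ q)

-- u is a vertex of t (the subtree rooted at a descendant of t, or t itself)
data _≼_ {n : ℕ} : Tree n → Tree n → Set where
  ≼-refl  : ∀ {t} → t ≼ t
  ≼-child : ∀ {u k} {cs : Fin (suc (suc k)) → Tree n} (i : Fin (suc (suc k))) →
            u ≼ cs i → u ≼ node cs

-- w branches towards leaves a and b through two different children
-- (image of the cherry vertex of ab|c in a subdivision)
data Splits {n : ℕ} (a b : Fin n) : Tree n → Set where
  splits : ∀ {k} {cs : Fin (suc (suc k)) → Tree n} (i j : Fin (suc (suc k))) →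
           i ≢ j → Pos (cs i) a → Pos (cs j) b → Splits a b (node cs)

-- u is the image of the root of ab|c: it has two different children,
-- one leading to leaf c and the other to a vertex w that splits a and b.
data RootImage {n : ℕ} (a b c : Fin n) : Tree n → Set where
  rootImage : ∀ {k} {cs : Fin (suc (suc k)) → Tree n} (i j : Fin (suc (suc k))) →
              i ≢ j → Pos (cs i) c → (∃ λ w → w ≼ cs j × Splits a b w) →
              RootImage a b c (node cs)

record RootedTriple (n : ℕ) : Set where
  field
    a b c : Fin n
    a≢b : a ≢ b
    a≢c : a ≢ c
    b≢c : b ≢ c

leafSet : ∀ {n} → RootedTriple n → Subset n
leafSet t = ⁅ RootedTriple.a t ⁆ ∪ (⁅ RootedTriple.b t ⁆ ∪ ⁅ RootedTriple.c t ⁆)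

-- T displays ab|c: some subdivision of ab|c is a subgraph of T, i.e. there
-- are vertices u (root image) and w (cherry image) with internally disjoint
-- directed paths u→c, u→w, w→a, w→b.
Displays : ∀ {n} → Tree n → RootedTriple n → Set
Displays T t = ∃ λ u → u ≼ T × RootImage (RootedTriple.a t) (RootedTriple.b t) (RootedTriple.c t) u

Compatible : ∀ {n} → List (RootedTriple n) → Set
Compatible {n} R = ∃ λ (T : Tree n) → IsXTree T × All (Displays T) R

Choice : ∀ {n} → List (Subset n) → Set
Choice {n} τ = All (λ s → Σ (RootedTriple n) (λ t → leafSet t ≡ s)) τ

chosen : ∀ {n} {τ : List (Subset n)} → Choice τ → List (RootedTriple n)
chosen All.[] = []
chosen (All._∷_ (t Data.Product., _) ch) = t Data.List.∷ chosen ch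

PhylogeneticallyFlexible : ∀ {n} → List (Subset n) → Set
PhylogeneticallyFlexible τ = (ch : Choice τ) → Compatible (chosen ch)

-- Encode a sub-collection of τ by a mask m of positions; thinness says that every non-empty
-- mask has surplus 2, |L(m)| ≥ |m| + 2.
--
-- Thin ⇒ flexible: fix the triples and build the tree top-down. On a leaf set C, the triples
-- inside C have surplus 2, so identifying the two cherry leaves of each of them still leaves
-- two classes of C. Two-colour C accordingly, recurse on both colour classes and join them
-- under a new root; a triple inside C is then displayed on one side or at the root.
--
-- Flexible ⇒ thin, by induction on |m|: the smaller masks have surplus 2, so m has surplus 1.
-- A Hall-type deletion argument shrinks every 3-set of m to a pair keeping surplus 1; choose
-- the triples with these pairs as cherries. A tree displaying them has a vertex splitting L(m)
-- in two non-empty sides with every cherry on one side, and surplus 1 on each side gives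
-- |L(m)| ≥ |m| + 2.

module Submission where

open import Defs
open import Data.Bool using (Bool; true; false)
open import Data.Empty using (⊥-elim)
open import Data.Fin using (Fin; zero; suc)
open import Data.Fin.Properties using (_≟_; any?)
open import Data.Fin.Subset
  using (Subset; ∣_∣; _∪_; _∩_; ∁; ⁅_⁆; ⊥; ⊤; _∈_; _∉_; _⊆_; _-_; Nonempty; Empty; inside; outside)
open import Data.Fin.Subset.Properties
import Data.Integer as ℤ
import Data.Integer.Properties as ℤ
open import Data.List using (List; []; _∷_; length; lookup)
open import Data.List.Membership.Propositional.Properties using (∈-lookup)
open import Data.List.Relation.Binary.Sublist.Heterogeneous using ([]; _∷ʳ_; _∷_)
import Data.List.Relation.Binary.Sublist.Propositional as Sublist
open import Data.List.Relation.Unary.All as All using (All; []; _∷_)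
open import Data.Nat using (ℕ; zero; suc; _+_; _≤_; _<_; z≤n; s≤s; _≤?_; _<?_)
open import Data.Nat.Properties
  using ( +-suc; +-comm; suc-injective; ≤-refl; ≤-reflexive; ≤-trans; ≤-antisym; ≤-pred; n≤1+n
        ; m≤m+n; m≤n+m; +-mono-≤; +-monoˡ-≤; +-monoˡ-<; +-monoʳ-<; n≮n; <⇒≱; ≰⇒>; ≮⇒≥
        ; module ≤-Reasoning )
open import Data.Nat.Tactic.RingSolver using (solve-∀)
open import Data.Product using (Σ; ∃; ∃₂; _×_; _,_; proj₁; proj₂)
open import Data.Sum using (_⊎_; inj₁; inj₂)
import Data.Sum
open import Data.Vec using (_∷_; []; tabulate; here; there)
open import Data.Vec.Functional using (updateAt)
open import Data.Vec.Functional.Properties using (updateAt-updates; updateAt-minimal)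
open import Data.Vec.Properties using (lookup∘tabulate; []=⇒lookup; lookup⇒[]=)
open import Function using (_∘_; _⇔_; mk⇔; Equivalence)
import Function.Properties.Equivalence as ⇔
open import Relation.Binary.PropositionalEquality
open import Relation.Nullary using (¬_; Dec; yes; no; does; contradiction)
open import Relation.Nullary.Decidable using (dec-true; dec-false; does-⇔; decidable-stable; _×-dec_; ¬?)

private variable
  n k : ℕ
  x y : Fin n
  p q : Subset n
  i : Fin k
  m m′ : Subset k
  F G : Fin k → Subset n

∣p∪q∣+∣p∩q∣≡∣p∣+∣q∣ : (p q : Subset n) → ∣ p ∪ q ∣ + ∣ p ∩ q ∣ ≡ ∣ p ∣ + ∣ q ∣
∣p∪q∣+∣p∩q∣≡∣p∣+∣q∣ []           []           = refl
∣p∪q∣+∣p∩q∣≡∣p∣+∣q∣ (inside ∷ p)  (inside ∷ q)  = cong suc (begin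
  ∣ p ∪ q ∣ + suc ∣ p ∩ q ∣  ≡⟨ +-suc ∣ p ∪ q ∣ ∣ p ∩ q ∣ ⟩
  suc (∣ p ∪ q ∣ + ∣ p ∩ q ∣) ≡⟨ cong suc (∣p∪q∣+∣p∩q∣≡∣p∣+∣q∣ p q) ⟩
  suc (∣ p ∣ + ∣ q ∣)         ≡⟨ +-suc ∣ p ∣ ∣ q ∣ ⟨
  ∣ p ∣ + suc ∣ q ∣           ∎)
  where open ≡-Reasoning
∣p∪q∣+∣p∩q∣≡∣p∣+∣q∣ (inside ∷ p)  (outside ∷ q) = cong suc (∣p∪q∣+∣p∩q∣≡∣p∣+∣q∣ p q)
∣p∪q∣+∣p∩q∣≡∣p∣+∣q∣ (outside ∷ p) (inside ∷ q)  =
  trans (cong suc (∣p∪q∣+∣p∩q∣≡∣p∣+∣q∣ p q)) (sym (+-suc ∣ p ∣ ∣ q ∣))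
∣p∪q∣+∣p∩q∣≡∣p∣+∣q∣ (outside ∷ p) (outside ∷ q) = ∣p∪q∣+∣p∩q∣≡∣p∣+∣q∣ p q

∣p∩q∣+∣p∩∁q∣≡∣p∣ : (p q : Subset n) → ∣ p ∩ q ∣ + ∣ p ∩ ∁ q ∣ ≡ ∣ p ∣
∣p∩q∣+∣p∩∁q∣≡∣p∣ []            []            = refl
∣p∩q∣+∣p∩∁q∣≡∣p∣ (inside ∷ p)  (inside ∷ q)  = cong suc (∣p∩q∣+∣p∩∁q∣≡∣p∣ p q)
∣p∩q∣+∣p∩∁q∣≡∣p∣ (inside ∷ p)  (outside ∷ q) =
  trans (+-suc ∣ p ∩ q ∣ ∣ p ∩ ∁ q ∣) (cong suc (∣p∩q∣+∣p∩∁q∣≡∣p∣ p q))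
∣p∩q∣+∣p∩∁q∣≡∣p∣ (outside ∷ p) (inside ∷ q)  = ∣p∩q∣+∣p∩∁q∣≡∣p∣ p q
∣p∩q∣+∣p∩∁q∣≡∣p∣ (outside ∷ p) (outside ∷ q) = ∣p∩q∣+∣p∩∁q∣≡∣p∣ p q

a+b+2≡a+1+b+1 : ∀ a b → a + b + 2 ≡ (a + 1) + (b + 1)
a+b+2≡a+1+b+1 = solve-∀

1+a+d+1≡a+d+1+1 : ∀ a d → suc a + d + 1 ≡ a + d + 1 + 1
1+a+d+1≡a+d+1+1 = solve-∀

a+d+b+d≡a+b+[d+d] : ∀ a d b → (a + d) + (b + d) ≡ a + b + (d + d)
a+d+b+d≡a+b+[d+d] = solve-∀

1+a+b+[d+d]≡a+d+b+d+1 : ∀ a b d → suc (a + b + (d + d)) ≡ (a + d) + (b + d + 1)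
1+a+b+[d+d]≡a+d+b+d+1 = solve-∀

Empty⇒∣p∣≡0 : Empty p → ∣ p ∣ ≡ 0
Empty⇒∣p∣≡0 {n} e = trans (cong ∣_∣ (Empty-unique e)) (∣⊥∣≡0 n)

∣p∪q∣≤∣p∣+∣q∣ : (p q : Subset n) → ∣ p ∪ q ∣ ≤ ∣ p ∣ + ∣ q ∣
∣p∪q∣≤∣p∣+∣q∣ p q = ≤-trans (m≤m+n ∣ p ∪ q ∣ ∣ p ∩ q ∣) (≤-reflexive (∣p∪q∣+∣p∩q∣≡∣p∣+∣q∣ p q))

Empty[p∩q]⇒∣p∪q∣≡∣p∣+∣q∣ : (p q : Subset n) → Empty (p ∩ q) → ∣ p ∪ q ∣ ≡ ∣ p ∣ + ∣ q ∣
Empty[p∩q]⇒∣p∪q∣≡∣p∣+∣q∣ p q e = begin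
  ∣ p ∪ q ∣             ≡⟨ +-comm 0 ∣ p ∪ q ∣ ⟩
  ∣ p ∪ q ∣ + 0         ≡⟨ cong (∣ p ∪ q ∣ +_) (Empty⇒∣p∣≡0 e) ⟨
  ∣ p ∪ q ∣ + ∣ p ∩ q ∣ ≡⟨ ∣p∪q∣+∣p∩q∣≡∣p∣+∣q∣ p q ⟩
  ∣ p ∣ + ∣ q ∣         ∎
  where open ≡-Reasoning

x∉p⇒∣p∪⁅x⁆∣≡∣p∣+1 : x ∉ p → ∣ p ∪ ⁅ x ⁆ ∣ ≡ ∣ p ∣ + 1
x∉p⇒∣p∪⁅x⁆∣≡∣p∣+1 {x = x} {p} x∉p =
  trans (Empty[p∩q]⇒∣p∪q∣≡∣p∣+∣q∣ p ⁅ x ⁆ disjoint) (cong (∣ p ∣ +_) (∣⁅x⁆∣≡1 x))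
  where
  disjoint : Empty (p ∩ ⁅ x ⁆)
  disjoint (z , z∈) with x∈p∩q⁻ p ⁅ x ⁆ z∈
  ... | z∈p , z∈⁅x⁆ rewrite x∈⁅y⁆⇒x≡y x z∈⁅x⁆ = x∉p z∈p

∣p∪⁅x⁆∣≤∣p∣+1 : (p : Subset n) (x : Fin n) → ∣ p ∪ ⁅ x ⁆ ∣ ≤ ∣ p ∣ + 1
∣p∪⁅x⁆∣≤∣p∣+1 p x = ≤-trans (∣p∪q∣≤∣p∣+∣q∣ p ⁅ x ⁆) (≤-reflexive (cong (∣ p ∣ +_) (∣⁅x⁆∣≡1 x)))

x∉p-x : (p : Subset n) (x : Fin n) → x ∉ p - x
x∉p-x (_ ∷ p) zero    ()
x∉p-x (_ ∷ p) (suc x) x∈ = x∉p-x p x (drop-there x∈)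

x∈p-y⇒x≢y : x ∈ p - y → x ≢ y
x∈p-y⇒x≢y {p = p} {y} x∈ refl = x∉p-x p y x∈

x∈p⇒∣p∣≡1+∣p-x∣ : x ∈ p → ∣ p ∣ ≡ suc ∣ p - x ∣
x∈p⇒∣p∣≡1+∣p-x∣ {x = zero}  {inside ∷ p}  _  = cong (suc ∘ ∣_∣) (sym (p─⊥≡p p))
x∈p⇒∣p∣≡1+∣p-x∣ {x = suc x} {inside ∷ p}  x∈ = cong suc (x∈p⇒∣p∣≡1+∣p-x∣ (drop-there x∈))
x∈p⇒∣p∣≡1+∣p-x∣ {x = suc x} {outside ∷ p} x∈ = x∈p⇒∣p∣≡1+∣p-x∣ (drop-there x∈)

∣p∣≤1+∣p-x∣ : (p : Subset n) (x : Fin n) → ∣ p ∣ ≤ suc ∣ p - x ∣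
∣p∣≤1+∣p-x∣ p x with x ∈? p
... | yes x∈p = ≤-reflexive (x∈p⇒∣p∣≡1+∣p-x∣ x∈p)
... | no  x∉p = ≤-trans (p⊆q⇒∣p∣≤∣q∣ p⊆p-x) (n≤1+n _)
  where
  p⊆p-x : p ⊆ p - x
  p⊆p-x y∈p = x∈p∧x≢y⇒x∈p-y y∈p λ { refl → x∉p y∈p }

x∈p⇒0<∣p∣ : x ∈ p → 0 < ∣ p ∣
x∈p⇒0<∣p∣ x∈p rewrite x∈p⇒∣p∣≡1+∣p-x∣ x∈p = s≤s z≤n

x∈p⇒y∈p⇒x≢y⇒1<∣p∣ : x ∈ p → y ∈ p → x ≢ y → 1 < ∣ p ∣
x∈p⇒y∈p⇒x≢y⇒1<∣p∣ x∈p y∈p x≢y rewrite x∈p⇒∣p∣≡1+∣p-x∣ x∈p =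
  s≤s (x∈p⇒0<∣p∣ (x∈p∧x≢y⇒x∈p-y y∈p (x≢y ∘ sym)))

0<∣p∣⇒Nonempty : (p : Subset n) → 0 < ∣ p ∣ → Nonempty p
0<∣p∣⇒Nonempty p 0<∣p∣ with nonempty? p
... | yes ne = ne
... | no ¬ne = ⊥-elim (n≮n 0 (subst (0 <_) (Empty⇒∣p∣≡0 ¬ne) 0<∣p∣))

1<∣p∣⇒distinct : (p : Subset n) → 1 < ∣ p ∣ → ∃₂ λ x y → x ∈ p × y ∈ p × x ≢ y
1<∣p∣⇒distinct p 1<∣p∣ with 0<∣p∣⇒Nonempty p (≤-trans (s≤s z≤n) 1<∣p∣)
... | x , x∈p with 0<∣p∣⇒Nonempty (p - x) (≤-pred (subst (1 <_) (x∈p⇒∣p∣≡1+∣p-x∣ x∈p) 1<∣p∣))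
... | y , y∈p-x = x , y , x∈p , p─q⊆p p ⁅ x ⁆ y∈p-x , λ x≡y → x∈p-y⇒x≢y y∈p-x (sym x≡y)

∣p∣≤1⇒x≡y : ∣ p ∣ ≤ 1 → x ∈ p → y ∈ p → x ≡ y
∣p∣≤1⇒x≡y {x = x} {y} ∣p∣≤1 x∈p y∈p with x ≟ y
... | yes x≡y = x≡y
... | no  x≢y = contradiction ∣p∣≤1 (<⇒≱ (x∈p⇒y∈p⇒x≢y⇒1<∣p∣ x∈p y∈p x≢y))

∣p∩q∣<∣p∣ : (p q : Subset n) → Nonempty (p ∩ ∁ q) → ∣ p ∩ q ∣ < ∣ p ∣
∣p∩q∣<∣p∣ p q (_ , x∈) = begin-strict
  ∣ p ∩ q ∣                  ≡⟨ +-comm 0 _ ⟩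
  ∣ p ∩ q ∣ + 0              <⟨ +-monoʳ-< ∣ p ∩ q ∣ (x∈p⇒0<∣p∣ x∈) ⟩
  ∣ p ∩ q ∣ + ∣ p ∩ ∁ q ∣    ≡⟨ ∣p∩q∣+∣p∩∁q∣≡∣p∣ p q ⟩
  ∣ p ∣                      ∎
  where open ≤-Reasoning

∣p∩∁q∣<∣p∣ : (p q : Subset n) → Nonempty (p ∩ q) → ∣ p ∩ ∁ q ∣ < ∣ p ∣
∣p∩∁q∣<∣p∣ p q (_ , x∈) = begin-strict
  ∣ p ∩ ∁ q ∣                ≡⟨ +-comm 0 _ ⟩
  ∣ p ∩ ∁ q ∣ + 0            <⟨ +-monoʳ-< ∣ p ∩ ∁ q ∣ (x∈p⇒0<∣p∣ x∈) ⟩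
  ∣ p ∩ ∁ q ∣ + ∣ p ∩ q ∣    ≡⟨ +-comm ∣ p ∩ ∁ q ∣ ∣ p ∩ q ∣ ⟩
  ∣ p ∩ q ∣ + ∣ p ∩ ∁ q ∣    ≡⟨ ∣p∩q∣+∣p∩∁q∣≡∣p∣ p q ⟩
  ∣ p ∣                      ∎
  where open ≤-Reasoning

x∈⁅y⁆∪q⁻ : (q : Subset n) → x ∈ ⁅ y ⁆ ∪ q → x ≡ y ⊎ x ∈ q
x∈⁅y⁆∪q⁻ {y = y} q x∈ with x∈p∪q⁻ ⁅ y ⁆ q x∈
... | inj₁ x∈⁅y⁆ = inj₁ (x∈⁅y⁆⇒x≡y y x∈⁅y⁆)
... | inj₂ x∈q   = inj₂ x∈q

x∈⁅x⁆∪q : (x : Fin n) (q : Subset n) → x ∈ ⁅ x ⁆ ∪ q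
x∈⁅x⁆∪q x q = p⊆p∪q q (x∈⁅x⁆ x)

⁅x⁆⊆p : x ∈ p → ⁅ x ⁆ ⊆ p
⁅x⁆⊆p {x = x} x∈p z∈ rewrite x∈⁅y⁆⇒x≡y x z∈ = x∈p

∪-lub : ∀ {r : Subset n} → p ⊆ r → q ⊆ r → p ∪ q ⊆ r
∪-lub {p = p} {q} p⊆r q⊆r z∈ with x∈p∪q⁻ p q z∈
... | inj₁ z∈p = p⊆r z∈p
... | inj₂ z∈q = q⊆r z∈q

x∈p⇒y∈p⇒∣p∣≡2⇒p≡⁅x⁆∪⁅y⁆ : x ∈ p → y ∈ p → x ≢ y → ∣ p ∣ ≡ 2 → p ≡ ⁅ x ⁆ ∪ ⁅ y ⁆
x∈p⇒y∈p⇒∣p∣≡2⇒p≡⁅x⁆∪⁅y⁆ {x = x} {p} {y} x∈p y∈p x≢y ∣p∣≡2 =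
  ⊆-antisym p⊆ (∪-lub (⁅x⁆⊆p x∈p) (⁅x⁆⊆p y∈p))
  where
  p⊆ : p ⊆ ⁅ x ⁆ ∪ ⁅ y ⁆
  p⊆ {z} z∈p with z ≟ x
  ... | yes refl = x∈⁅x⁆∪q x ⁅ y ⁆
  ... | no  z≢x  = subst (_∈ ⁅ x ⁆ ∪ ⁅ y ⁆) (sym z≡y) (q⊆p∪q ⁅ x ⁆ ⁅ y ⁆ (x∈⁅x⁆ y))
    where
    ∣p-x∣≤1 : ∣ p - x ∣ ≤ 1
    ∣p-x∣≤1 = ≤-pred (≤-reflexive (trans (sym (x∈p⇒∣p∣≡1+∣p-x∣ x∈p)) ∣p∣≡2))
    z≡y : z ≡ y
    z≡y = ∣p∣≤1⇒x≡y ∣p-x∣≤1 (x∈p∧x≢y⇒x∈p-y z∈p z≢x) (x∈p∧x≢y⇒x∈p-y y∈p (x≢y ∘ sym))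

∣p∣≡2+∣p-x-y∣ : x ∈ p → y ∈ p → x ≢ y → ∣ p ∣ ≡ 2 + ∣ p - x - y ∣
∣p∣≡2+∣p-x-y∣ x∈p y∈p x≢y =
  trans (x∈p⇒∣p∣≡1+∣p-x∣ x∈p) (cong suc (x∈p⇒∣p∣≡1+∣p-x∣ (x∈p∧x≢y⇒x∈p-y y∈p (x≢y ∘ sym))))

third-element : x ∈ p → y ∈ p → x ≢ y → ∣ p ∣ ≡ 3 →
                ∃ λ z → x ≢ z × y ≢ z × ⁅ x ⁆ ∪ (⁅ y ⁆ ∪ ⁅ z ⁆) ≡ p
third-element {x = x} {p} {y} x∈p y∈p x≢y ∣p∣≡3 =
  z , x≢z , y≢z , ⊆-antisym (∪-lub (⁅x⁆⊆p x∈p) (∪-lub (⁅x⁆⊆p y∈p) (⁅x⁆⊆p z∈p))) p⊆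
  where
  ∣p-x-y∣≡1 : ∣ p - x - y ∣ ≡ 1
  ∣p-x-y∣≡1 = suc-injective (suc-injective (trans (sym (∣p∣≡2+∣p-x-y∣ x∈p y∈p x≢y)) ∣p∣≡3))
  z : Fin _
  z = proj₁ (0<∣p∣⇒Nonempty (p - x - y) (≤-reflexive (sym ∣p-x-y∣≡1)))
  z∈p-x-y : z ∈ p - x - y
  z∈p-x-y = proj₂ (0<∣p∣⇒Nonempty (p - x - y) (≤-reflexive (sym ∣p-x-y∣≡1)))
  z∈p-x : z ∈ p - x
  z∈p-x = p─q⊆p _ _ z∈p-x-y
  z∈p : z ∈ p
  z∈p = p─q⊆p _ _ z∈p-x
  x≢z : x ≢ z
  x≢z = x∈p-y⇒x≢y z∈p-x ∘ sym
  y≢z : y ≢ z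
  y≢z = x∈p-y⇒x≢y z∈p-x-y ∘ sym
  p⊆ : p ⊆ ⁅ x ⁆ ∪ (⁅ y ⁆ ∪ ⁅ z ⁆)
  p⊆ {w} w∈p with w ≟ x | w ≟ y
  ... | yes refl | _        = x∈⁅x⁆∪q x _
  ... | no  _    | yes refl = q⊆p∪q ⁅ x ⁆ _ (x∈⁅x⁆∪q y _)
  ... | no  w≢x  | no  w≢y  = q⊆p∪q ⁅ x ⁆ _ (q⊆p∪q ⁅ y ⁆ _ (subst (_∈ ⁅ z ⁆) (sym w≡z) (x∈⁅x⁆ z)))
    where
    w∈p-x-y : w ∈ p - x - y
    w∈p-x-y = x∈p∧x≢y⇒x∈p-y (x∈p∧x≢y⇒x∈p-y w∈p w≢x) w≢y
    w≡z : w ≡ z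
    w≡z = ∣p∣≤1⇒x≡y (≤-reflexive ∣p-x-y∣≡1) w∈p-x-y z∈p-x-y

module _ (t : RootedTriple n) where
  open RootedTriple t

  a∈leafSet : a ∈ leafSet t
  a∈leafSet = x∈⁅x⁆∪q a _

  b∈leafSet : b ∈ leafSet t
  b∈leafSet = q⊆p∪q ⁅ a ⁆ _ (x∈⁅x⁆∪q b _)

  c∈leafSet : c ∈ leafSet t
  c∈leafSet = q⊆p∪q ⁅ a ⁆ _ (q⊆p∪q ⁅ b ⁆ _ (x∈⁅x⁆ c))

  leafSet⊆ : a ∈ p → b ∈ p → c ∈ p → leafSet t ⊆ p
  leafSet⊆ a∈p b∈p c∈p = ∪-lub (⁅x⁆⊆p a∈p) (∪-lub (⁅x⁆⊆p b∈p) (⁅x⁆⊆p c∈p))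

∈-tabulate⁺ : (f : Fin n → Bool) → f x ≡ true → x ∈ tabulate f
∈-tabulate⁺ {x = x} f fx≡true = lookup⇒[]= x (tabulate f) (trans (lookup∘tabulate f x) fx≡true)

∈-tabulate⁻ : (f : Fin n → Bool) → x ∈ tabulate f → f x ≡ true
∈-tabulate⁻ {x = x} f x∈ = trans (sym (lookup∘tabulate f x)) ([]=⇒lookup x∈)

∈-∁tabulate⁺ : (f : Fin n → Bool) → f x ≡ false → x ∈ ∁ (tabulate f)
∈-∁tabulate⁺ f fx≡false = x∉p⇒x∈∁p λ x∈ → contradiction (trans (sym (∈-tabulate⁻ f x∈)) fx≡false) λ ()

∈-∁tabulate⁻ : (f : Fin n → Bool) → x ∈ ∁ (tabulate f) → f x ≡ false
∈-∁tabulate⁻ {x = x} f x∈ with f x in fx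
... | true  = contradiction (∈-tabulate⁺ f fx) (x∈∁p⇒x∉p x∈)
... | false = refl

-- Unions over index masks, and surplus

-- With F = lookup τ, a mask m : Subset (length τ) stands for a sub-collection of τ.
L[_]_ : (Fin k → Subset n) → Subset k → Subset n
L[ F ] []            = ⊥
L[ F ] (outside ∷ m) = L[ F ∘ suc ] m
L[ F ] (inside ∷ m)  = F zero ∪ L[ F ∘ suc ] m

∈-L⁺ : ∀ {F : Fin k → Subset n} {m i} → i ∈ m → x ∈ F i → x ∈ L[ F ] m
∈-L⁺ {m = inside ∷ m}          {i = zero}  _      x∈ = p⊆p∪q _ x∈
∈-L⁺ {F = F} {m = inside ∷ m}  {i = suc i} i∈m x∈ = q⊆p∪q (F zero) _ (∈-L⁺ {F = F ∘ suc} (drop-there i∈m) x∈)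
∈-L⁺ {F = F} {m = outside ∷ m} {i = suc i} i∈m x∈ = ∈-L⁺ {F = F ∘ suc} (drop-there i∈m) x∈

∈-L⁻ : (m : Subset k) → x ∈ L[ F ] m → ∃ λ i → i ∈ m × x ∈ F i
∈-L⁻ [] x∈ = contradiction x∈ ∉⊥
∈-L⁻ {F = F} (outside ∷ m) x∈ with ∈-L⁻ {F = F ∘ suc} m x∈
... | i , i∈m , x∈Fi = suc i , there i∈m , x∈Fi
∈-L⁻ {F = F} (inside ∷ m) x∈ with x∈p∪q⁻ (F zero) _ x∈
... | inj₁ x∈F0 = zero , here , x∈F0
... | inj₂ x∈L with ∈-L⁻ {F = F ∘ suc} m x∈L
...   | i , i∈m , x∈Fi = suc i , there i∈m , x∈Fi

L-least : (∀ {i} → i ∈ m → F i ⊆ p) → L[ F ] m ⊆ p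
L-least {m = m} Fi⊆p x∈ with ∈-L⁻ m x∈
... | i , i∈m , x∈Fi = Fi⊆p i∈m x∈Fi

L-mono : m ⊆ m′ → L[ F ] m ⊆ L[ F ] m′
L-mono m⊆m′ = L-least λ i∈m → ∈-L⁺ (m⊆m′ i∈m)

L-cong : ∀ {F G : Fin k → Subset n} {m} → (∀ i → F i ≡ G i) → L[ F ] m ≡ L[ G ] m
L-cong {F = F} {G} {m} F≗G =
  ⊆-antisym (L-least {m = m} λ {i} i∈m → ∈-L⁺ {F = G} i∈m ∘ ⊆-reflexive (F≗G i))
            (L-least {m = m} λ {i} i∈m → ∈-L⁺ {F = F} i∈m ∘ ⊆-reflexive (sym (F≗G i)))

HasSurplus : ℕ → (Fin k → Subset n) → Subset k → Set
HasSurplus d F m = ∀ {m′} → m′ ⊆ m → Nonempty m′ → ∣ m′ ∣ + d ≤ ∣ L[ F ] m′ ∣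

HasSurplus-mono : ∀ {d} → (∀ {i} → i ∈ m → F i ⊆ G i) → HasSurplus d F m → HasSurplus d G m
HasSurplus-mono F⊆G surplus m′⊆m ne =
  ≤-trans (surplus m′⊆m ne) (p⊆q⇒∣p∣≤∣q∣ (L-least λ i∈m′ → ∈-L⁺ i∈m′ ∘ F⊆G (m′⊆m i∈m′)))

HasSurplus-part : ∀ {d} → HasSurplus d F m → m′ ⊆ m → ∀ {S} → L[ F ] m′ ⊆ S → d ≤ ∣ S ∣ → ∣ m′ ∣ + d ≤ ∣ S ∣
HasSurplus-part {m′ = m′} {d} surplus m′⊆m {S} L⊆S d≤∣S∣ with nonempty? m′
... | yes m′≠∅ = ≤-trans (surplus m′⊆m m′≠∅) (p⊆q⇒∣p∣≤∣q∣ L⊆S)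
... | no  m′=∅ = subst (λ a → a + d ≤ ∣ S ∣) (sym (Empty⇒∣p∣≡0 m′=∅)) d≤∣S∣

HasSurplus-from-smaller : ∀ {d} {F : Fin k → Subset n} {m} → (∀ {i} → i ∈ m → d + 1 ≤ ∣ F i ∣) →
  (∀ {m′} → ∣ m′ ∣ < ∣ m ∣ → Nonempty m′ → ∣ m′ ∣ + suc d ≤ ∣ L[ F ] m′ ∣) → HasSurplus d F m
HasSurplus-from-smaller {d = d} {F} {m} big smaller {m′} m′⊆m (i , i∈m′)
  rewrite x∈p⇒∣p∣≡1+∣p-x∣ i∈m′ with nonempty? (m′ - i)
... | yes m′-i≠∅ = begin
  suc ∣ m′ - i ∣ + d        ≡⟨ +-suc ∣ m′ - i ∣ d ⟨
  ∣ m′ - i ∣ + suc d        ≤⟨ smaller ∣m′-i∣<∣m∣ m′-i≠∅ ⟩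
  ∣ L[ F ] (m′ - i) ∣       ≤⟨ p⊆q⇒∣p∣≤∣q∣ (L-mono (p─q⊆p m′ ⁅ i ⁆)) ⟩
  ∣ L[ F ] m′ ∣             ∎
  where
  open ≤-Reasoning
  ∣m′-i∣<∣m∣ : ∣ m′ - i ∣ < ∣ m ∣
  ∣m′-i∣<∣m∣ = ≤-trans (≤-reflexive (sym (x∈p⇒∣p∣≡1+∣p-x∣ i∈m′))) (p⊆q⇒∣p∣≤∣q∣ m′⊆m)
... | no  m′-i=∅ rewrite Empty⇒∣p∣≡0 m′-i=∅ =
  ≤-trans (≤-reflexive (+-comm 1 d)) (≤-trans (big (m′⊆m i∈m′)) (p⊆q⇒∣p∣≤∣q∣ (∈-L⁺ i∈m′)))

0≤exc⇔length+2≤∣L∣ : (τ : List (Subset n)) → ℤ.+ 0 ℤ.≤ exc τ ⇔ length τ + 2 ≤ ∣ L τ ∣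
0≤exc⇔length+2≤∣L∣ τ =
  mk⇔ (λ 0≤exc → ℤ.drop‿+≤+ (ℤ.0≤i-j⇒j≤i (subst (ℤ.+ 0 ℤ.≤_) exc≡ 0≤exc)))
      (λ len+2≤ → subst (ℤ.+ 0 ℤ.≤_) (sym exc≡) (ℤ.i≤j⇒0≤j-i (ℤ.+≤+ len+2≤)))
  where
  open ≡-Reasoning
  a b : ℤ.ℤ
  a = ℤ.+ ∣ L τ ∣
  b = ℤ.+ length τ
  exc≡ : exc τ ≡ a ℤ.- ℤ.+ (length τ + 2)
  exc≡ = begin
    a ℤ.- b ℤ.- ℤ.+ 2                  ≡⟨ ℤ.+-assoc a (ℤ.- b) (ℤ.- ℤ.+ 2) ⟩
    a ℤ.+ (ℤ.- b ℤ.+ ℤ.- ℤ.+ 2)        ≡⟨ cong (λ c → a ℤ.+ c) (ℤ.neg-distrib-+ b (ℤ.+ 2)) ⟨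
    a ℤ.- (b ℤ.+ ℤ.+ 2)                ≡⟨ cong (λ c → a ℤ.- c) (ℤ.pos-+ (length τ) 2) ⟨
    a ℤ.- ℤ.+ (length τ + 2)           ∎

sublist⇒mask : {τ′ τ : List (Subset n)} → τ′ Sublist.⊆ τ →
               ∃ λ m → L τ′ ≡ L[ lookup τ ] m × length τ′ ≡ ∣ m ∣
sublist⇒mask [] = [] , refl , refl
sublist⇒mask (_ ∷ʳ τ′⊆τ) with sublist⇒mask τ′⊆τ
... | m , L≡ , len≡ = outside ∷ m , L≡ , len≡
sublist⇒mask (refl ∷ τ′⊆τ) with sublist⇒mask τ′⊆τ
... | m , L≡ , len≡ = inside ∷ m , cong (_ ∪_) L≡ , cong suc len≡

mask⇒sublist : (τ : List (Subset n)) (m : Subset (length τ)) →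
               ∃ λ τ′ → τ′ Sublist.⊆ τ × L τ′ ≡ L[ lookup τ ] m × length τ′ ≡ ∣ m ∣
mask⇒sublist []      []            = [] , [] , refl , refl
mask⇒sublist (s ∷ τ) (outside ∷ m) with mask⇒sublist τ m
... | τ′ , τ′⊆τ , L≡ , len≡ = τ′ , s ∷ʳ τ′⊆τ , L≡ , len≡
mask⇒sublist (s ∷ τ) (inside ∷ m)  with mask⇒sublist τ m
... | τ′ , τ′⊆τ , L≡ , len≡ = s ∷ τ′ , refl ∷ τ′⊆τ , cong (s ∪_) L≡ , cong suc len≡

Thin⇔HasSurplus₂ : (τ : List (Subset n)) → Thin τ ⇔ HasSurplus 2 (lookup τ) ⊤
Thin⇔HasSurplus₂ τ = mk⇔ to from
  where
  to : Thin τ → HasSurplus 2 (lookup τ) ⊤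
  to thin {m} _ (_ , i∈m) with mask⇒sublist τ m
  ... | τ′ , τ′⊆τ , L≡ , len≡ =
    subst₂ (λ a b → a + 2 ≤ ∣ b ∣) len≡ L≡ (Equivalence.to (0≤exc⇔length+2≤∣L∣ τ′) (thin τ′ τ′⊆τ τ′≢[]))
    where
    τ′≢[] : τ′ ≢ []
    τ′≢[] refl = contradiction (x∈p⇒0<∣p∣ i∈m) (subst (λ a → ¬ 0 < a) len≡ λ ())
  from : HasSurplus 2 (lookup τ) ⊤ → Thin τ
  from surplus τ′ τ′⊆τ τ′≢[] with sublist⇒mask τ′⊆τ
  ... | m , L≡ , len≡ =
    Equivalence.from (0≤exc⇔length+2≤∣L∣ τ′) (subst₂ (λ a b → a + 2 ≤ ∣ b ∣) (sym len≡) (sym L≡) (surplus ⊆⊤ m≠∅))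
    where
    0<length : (xs : List (Subset n)) → xs ≢ [] → 0 < length xs
    0<length []      xs≢[] = contradiction refl xs≢[]
    0<length (_ ∷ _) _     = s≤s z≤n
    m≠∅ : Nonempty m
    m≠∅ = 0<∣p∣⇒Nonempty m (subst (0 <_) len≡ (0<length τ′ τ′≢[]))

-- Two-colourings

Bichromatic : (Fin n → Bool) → Subset n → Set
Bichromatic col C = (∃ λ x → x ∈ C × col x ≡ true) × (∃ λ y → y ∈ C × col y ≡ false)

Edge : (E₁ E₂ : Fin k → Fin n) → Fin k → Subset n
Edge E₁ E₂ i = ⁅ E₁ i ⁆ ∪ ⁅ E₂ i ⁆

RespectsEdges : (Fin n → Bool) → (E₁ E₂ : Fin k → Fin n) → Subset k → Set
RespectsEdges col E₁ E₂ m = ∀ {i} → i ∈ m → col (E₁ i) ≡ col (E₂ i)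

merge : Fin n → Fin n → Fin n → Fin n
merge a b z with z ≟ b
... | yes _ = a
... | no  _ = z

merge-≢ : (a : Fin n) {b z : Fin n} → z ≢ b → merge a b z ≡ z
merge-≢ a {b} {z} z≢b with z ≟ b
... | yes z≡b = contradiction z≡b z≢b
... | no  _   = refl

merge-a : (a b : Fin n) → merge a b a ≡ a
merge-a a b with a ≟ b
... | yes _ = refl
... | no  _ = refl

merge-b : (a b : Fin n) → merge a b b ≡ a
merge-b a b with b ≟ b
... | yes _   = refl
... | no  b≢b = contradiction refl b≢b

Bichromatic-merge : ∀ {col} (a b : Fin n) {C : Subset n} →
                    Bichromatic col (C - b) → Bichromatic (col ∘ merge a b) C
Bichromatic-merge {col = col} a b ((x , x∈ , cx) , (y , y∈ , cy)) =
  (x , p─q⊆p _ _ x∈ , trans (cong col (merge-≢ a (x∈p-y⇒x≢y x∈))) cx) ,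
  (y , p─q⊆p _ _ y∈ , trans (cong col (merge-≢ a (x∈p-y⇒x≢y y∈))) cy)

-- Identifying the endpoints of one edge at a time costs at most one point of C per edge,
-- so at least two classes of C survive all |m| identifications.
contraction-colouring : (E₁ E₂ : Fin k → Fin n) (m : Subset k) (C : Subset n) → ∣ m ∣ + 2 ≤ ∣ C ∣ →
                        ∃ λ col → RespectsEdges col E₁ E₂ m × Bichromatic col C
contraction-colouring E₁ E₂ [] C 1<∣C∣ with 1<∣p∣⇒distinct C 1<∣C∣
... | x , y , x∈C , y∈C , x≢y =
  col , (λ ()) , (x , x∈C , dec-true (x ≟ x) refl) , (y , y∈C , dec-false (y ≟ x) (x≢y ∘ sym))
  where
  col : Fin _ → Bool
  col z = does (z ≟ x)
contraction-colouring E₁ E₂ (outside ∷ m) C ∣m∣+2≤∣C∣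
  with contraction-colouring (E₁ ∘ suc) (E₂ ∘ suc) m C ∣m∣+2≤∣C∣
... | col , respects , bichromatic = col , (λ { (there i∈m) → respects i∈m }) , bichromatic
contraction-colouring E₁ E₂ (inside ∷ m) C ∣m∣+3≤∣C∣ =
  pull (contraction-colouring (merge a b ∘ E₁ ∘ suc) (merge a b ∘ E₂ ∘ suc) m (C - b) ∣m∣+2≤∣C-b∣)
  where
  a b : Fin _
  a = E₁ zero
  b = E₂ zero
  ∣m∣+2≤∣C-b∣ : ∣ m ∣ + 2 ≤ ∣ C - b ∣
  ∣m∣+2≤∣C-b∣ = ≤-pred (≤-trans ∣m∣+3≤∣C∣ (∣p∣≤1+∣p-x∣ C b))
  pull : (∃ λ col → RespectsEdges col (merge a b ∘ E₁ ∘ suc) (merge a b ∘ E₂ ∘ suc) m × Bichromatic col (C - b)) →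
         ∃ λ col → RespectsEdges col E₁ E₂ (inside ∷ m) × Bichromatic col C
  pull (col , respects , bichromatic) = col ∘ merge a b , respects′ , Bichromatic-merge a b bichromatic
    where
    respects′ : RespectsEdges (col ∘ merge a b) E₁ E₂ (inside ∷ m)
    respects′ here        = cong col (trans (merge-a a b) (sym (merge-b a b)))
    respects′ (there i∈m) = respects i∈m

∈-Edge⇒colour : ∀ {col} {E₁ E₂ : Fin k → Fin n} → RespectsEdges col E₁ E₂ m →
                i ∈ m → x ∈ Edge E₁ E₂ i → col x ≡ col (E₁ i)
∈-Edge⇒colour {i = i} {E₁ = E₁} {E₂} respects i∈m x∈ with x∈⁅y⁆∪q⁻ ⁅ E₂ i ⁆ x∈
... | inj₁ refl = refl
... | inj₂ x∈⁅E₂i⁆ rewrite x∈⁅y⁆⇒x≡y (E₂ i) x∈⁅E₂i⁆ = sym (respects i∈m)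

-- Split m by the colour of its edges; each half keeps surplus 1 inside its colour class of S.
HasSurplus₁-monochromatic : ∀ {col} {E₁ E₂ : Fin k → Fin n} {S : Subset n} →
  HasSurplus 1 (Edge E₁ E₂) m → RespectsEdges col E₁ E₂ m → L[ Edge E₁ E₂ ] m ⊆ S →
  Bichromatic col S → ∣ m ∣ + 2 ≤ ∣ S ∣
HasSurplus₁-monochromatic {m = m} {col = col} {E₁} {E₂} {S} surplus respects L⊆S
  ((x , x∈S , cx) , (y , y∈S , cy)) = begin
    ∣ m ∣ + 2                         ≡⟨ cong (_+ 2) (∣p∩q∣+∣p∩∁q∣≡∣p∣ m mT) ⟨
    ∣ m ∩ mT ∣ + ∣ m ∩ ∁ mT ∣ + 2     ≡⟨ a+b+2≡a+1+b+1 ∣ m ∩ mT ∣ ∣ m ∩ ∁ mT ∣ ⟩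
    (∣ m ∩ mT ∣ + 1) + (∣ m ∩ ∁ mT ∣ + 1)
      ≤⟨ +-mono-≤ (HasSurplus-part surplus (p∩q⊆p m mT) L⊆ST (x∈p⇒0<∣p∣ (x∈p∩q⁺ (x∈S , ∈-tabulate⁺ col cx))))
                  (HasSurplus-part surplus (p∩q⊆p m (∁ mT)) L⊆SF (x∈p⇒0<∣p∣ (x∈p∩q⁺ (y∈S , ∈-∁tabulate⁺ col cy)))) ⟩
    ∣ S ∩ tabulate col ∣ + ∣ S ∩ ∁ (tabulate col) ∣ ≡⟨ ∣p∩q∣+∣p∩∁q∣≡∣p∣ S (tabulate col) ⟩
    ∣ S ∣                             ∎
  where
  open ≤-Reasoning
  mT : Subset _
  mT = tabulate (col ∘ E₁)
  L⊆ST : L[ Edge E₁ E₂ ] (m ∩ mT) ⊆ S ∩ tabulate col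
  L⊆ST = L-least λ {i} i∈ z∈ → let (i∈m , i∈mT) = x∈p∩q⁻ m mT i∈ in
    x∈p∩q⁺ (L⊆S (∈-L⁺ i∈m z∈) ,
            ∈-tabulate⁺ col (trans (∈-Edge⇒colour {col = col} {E₁ = E₁} {E₂} respects i∈m z∈) (∈-tabulate⁻ (col ∘ E₁) i∈mT)))
  L⊆SF : L[ Edge E₁ E₂ ] (m ∩ ∁ mT) ⊆ S ∩ ∁ (tabulate col)
  L⊆SF = L-least λ {i} i∈ z∈ → let (i∈m , i∈∁mT) = x∈p∩q⁻ m (∁ mT) i∈ in
    x∈p∩q⁺ (L⊆S (∈-L⁺ i∈m z∈) ,
            ∈-∁tabulate⁺ col (trans (∈-Edge⇒colour {col = col} {E₁ = E₁} {E₂} respects i∈m z∈) (∈-∁tabulate⁻ (col ∘ E₁) i∈∁mT)))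

-- Shrinking a family with surplus

L-submodular : (F : Fin k → Subset n) (m₁ m₂ : Subset k) →
               ∣ L[ F ] (m₁ ∪ m₂) ∣ + ∣ L[ F ] (m₁ ∩ m₂) ∣ ≤ ∣ L[ F ] m₁ ∣ + ∣ L[ F ] m₂ ∣
L-submodular F m₁ m₂ = begin
  ∣ L[ F ] (m₁ ∪ m₂) ∣ + ∣ L[ F ] (m₁ ∩ m₂) ∣ ≤⟨ +-mono-≤ (p⊆q⇒∣p∣≤∣q∣ L∪⊆) (p⊆q⇒∣p∣≤∣q∣ L∩⊆) ⟩
  ∣ L[ F ] m₁ ∪ L[ F ] m₂ ∣ + ∣ L[ F ] m₁ ∩ L[ F ] m₂ ∣ ≡⟨ ∣p∪q∣+∣p∩q∣≡∣p∣+∣q∣ (L[ F ] m₁) (L[ F ] m₂) ⟩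
  ∣ L[ F ] m₁ ∣ + ∣ L[ F ] m₂ ∣ ∎
  where
  open ≤-Reasoning
  L∪⊆ : L[ F ] (m₁ ∪ m₂) ⊆ L[ F ] m₁ ∪ L[ F ] m₂
  L∪⊆ = L-least λ {i} i∈ x∈ → x∈p∪q⁺ (Data.Sum.map (λ i∈m₁ → ∈-L⁺ i∈m₁ x∈) (λ i∈m₂ → ∈-L⁺ i∈m₂ x∈) (x∈p∪q⁻ m₁ m₂ i∈))
  L∩⊆ : L[ F ] (m₁ ∩ m₂) ⊆ L[ F ] m₁ ∩ L[ F ] m₂
  L∩⊆ x∈ = x∈p∩q⁺ (L-mono (p∩q⊆p m₁ m₂) x∈ , L-mono (p∩q⊆q m₁ m₂) x∈)

Violation : ℕ → (Fin k → Subset n) → Subset k → Subset k → Set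
Violation d F m m′ = m′ ⊆ m × Nonempty m′ × ∣ L[ F ] m′ ∣ < ∣ m′ ∣ + d

HasSurplus-or-Violation : ∀ d (F : Fin k → Subset n) m → HasSurplus d F m ⊎ ∃ (Violation d F m)
HasSurplus-or-Violation d F m
  with anySubset? (λ m′ → (m′ ⊆? m) ×-dec nonempty? m′ ×-dec (∣ L[ F ] m′ ∣ <? ∣ m′ ∣ + d))
... | yes violation = inj₂ violation
... | no  none      = inj₁ λ {m′} m′⊆m m′≠∅ → ≮⇒≥ λ L< → none (m′ , m′⊆m , m′≠∅ , L<)

deleteAt : (Fin k → Subset n) → Fin k → Fin n → Fin k → Subset n
deleteAt G i v = updateAt G i (_- v)

deleteAt-⊆ : ∀ (G : Fin k → Subset n) i v j → deleteAt G i v j ⊆ G j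
deleteAt-⊆ G i v j with j ≟ i
... | yes refl = subst (_⊆ G i) (sym (updateAt-updates i G)) (p─q⊆p (G i) ⁅ v ⁆)
... | no  j≢i  = ⊆-reflexive (updateAt-minimal j i G j≢i)

∈-deleteAt⁺ : ∀ (G : Fin k → Subset n) {i j v} → x ∈ G j → (j ≡ i → x ≢ v) → x ∈ deleteAt G i v j
∈-deleteAt⁺ {x = x} G {i} {j} x∈ ok with j ≟ i
... | yes refl = subst (x ∈_) (sym (updateAt-updates i G)) (x∈p∧x≢y⇒x∈p-y x∈ (ok refl))
... | no  j≢i  = subst (x ∈_) (sym (updateAt-minimal j i G j≢i)) x∈

L-deleteAt-⊆ : ∀ (G : Fin k → Subset n) i v m → L[ G ] m ⊆ L[ deleteAt G i v ] m ∪ ⁅ v ⁆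
L-deleteAt-⊆ G i v m {x} x∈ with ∈-L⁻ m x∈ | x ≟ v
... | _              | yes refl = q⊆p∪q _ ⁅ v ⁆ (x∈⁅x⁆ v)
... | j , j∈m , x∈Gj | no  x≢v  = p⊆p∪q ⁅ v ⁆ (∈-L⁺ j∈m (∈-deleteAt⁺ G x∈Gj λ _ → x≢v))

L-deleteAt-⊇ : ∀ (G : Fin k → Subset n) i v m →
               (i ∈ m → v ∈ L[ G ] (m - i)) → L[ G ] m ⊆ L[ deleteAt G i v ] m
L-deleteAt-⊇ G i v m v-elsewhere {x} x∈ with ∈-L⁻ m x∈
... | j , j∈m , x∈Gj with j ≟ i | x ≟ v
...   | yes refl | yes refl = let (j′ , j′∈m-i , v∈Gj′) = ∈-L⁻ (m - i) (v-elsewhere j∈m) in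
  ∈-L⁺ (p─q⊆p m ⁅ i ⁆ j′∈m-i) (∈-deleteAt⁺ G v∈Gj′ λ j′≡i → contradiction j′≡i (x∈p-y⇒x≢y j′∈m-i))
...   | _        | no  x≢v  = ∈-L⁺ j∈m (∈-deleteAt⁺ G x∈Gj λ _ → x≢v)
...   | no  j≢i  | _        = ∈-L⁺ j∈m (∈-deleteAt⁺ G x∈Gj λ j≡i → contradiction j≡i j≢i)

Violation-deleteAt : ∀ {d} {G : Fin k → Subset n} {i v m₁} → HasSurplus d G m →
                     Violation d (deleteAt G i v) m m₁ →
                     ∣ L[ G ] m₁ ∣ ≤ ∣ m₁ ∣ + d × i ∈ m₁ × v ∉ L[ G ] (m₁ - i)
Violation-deleteAt {d = d} {G} {i} {v} {m₁} surplus (m₁⊆m , m₁≠∅ , L′<) = tight , i∈m₁ , v∉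
  where
  not-covered : ¬ (L[ G ] m₁ ⊆ L[ deleteAt G i v ] m₁)
  not-covered L⊆L′ = <⇒≱ L′< (≤-trans (surplus m₁⊆m m₁≠∅) (p⊆q⇒∣p∣≤∣q∣ L⊆L′))
  tight : ∣ L[ G ] m₁ ∣ ≤ ∣ m₁ ∣ + d
  tight = ≤-trans (p⊆q⇒∣p∣≤∣q∣ (L-deleteAt-⊆ G i v m₁))
                  (≤-trans (∣p∪⁅x⁆∣≤∣p∣+1 (L[ deleteAt G i v ] m₁) v)
                           (subst (_≤ ∣ m₁ ∣ + d) (+-comm 1 _) L′<))
  i∈m₁ : i ∈ m₁
  i∈m₁ with i ∈? m₁
  ... | yes i∈ = i∈
  ... | no  i∉ = ⊥-elim (not-covered (L-deleteAt-⊇ G i v m₁ λ i∈ → contradiction i∈ i∉))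
  v∉ : v ∉ L[ G ] (m₁ - i)
  v∉ v∈ = not-covered (L-deleteAt-⊇ G i v m₁ λ _ → v∈)

private-points⇒surplus+1 : ∀ {d} {G : Fin k → Subset n} {I i v₁ v₂} → HasSurplus d G m → I ⊆ m → i ∈ I →
  d + 2 ≤ ∣ G i ∣ → v₁ ∈ G i → v₂ ∈ G i → v₁ ≢ v₂ → v₁ ∉ L[ G ] (I - i) → v₂ ∉ L[ G ] (I - i) →
  ∣ I ∣ + d + 1 ≤ ∣ L[ G ] I ∣
private-points⇒surplus+1 {d = d} {G} {I} {i} {v₁} {v₂} surplus I⊆m i∈I d+2≤∣Gi∣ v₁∈ v₂∈ v₁≢v₂ v₁∉ v₂∉
  rewrite x∈p⇒∣p∣≡1+∣p-x∣ i∈I with nonempty? (I - i)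
... | yes I-i≠∅ = begin
  suc ∣ I - i ∣ + d + 1      ≡⟨ 1+a+d+1≡a+d+1+1 ∣ I - i ∣ d ⟩
  ∣ I - i ∣ + d + 1 + 1      ≤⟨ +-monoˡ-≤ 1 (+-monoˡ-≤ 1 (surplus (⊆-trans (p─q⊆p I ⁅ i ⁆) I⊆m) I-i≠∅)) ⟩
  ∣ R ∣ + 1 + 1              ≡⟨ cong (_+ 1) (x∉p⇒∣p∪⁅x⁆∣≡∣p∣+1 v₁∉) ⟨
  ∣ R ∪ ⁅ v₁ ⁆ ∣ + 1         ≡⟨ x∉p⇒∣p∪⁅x⁆∣≡∣p∣+1 v₂∉R∪v₁ ⟨
  ∣ (R ∪ ⁅ v₁ ⁆) ∪ ⁅ v₂ ⁆ ∣  ≤⟨ p⊆q⇒∣p∣≤∣q∣ (∪-lub (∪-lub (L-mono (p─q⊆p I ⁅ i ⁆)) (⁅x⁆⊆p (∈-L⁺ i∈I v₁∈)))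
                                                  (⁅x⁆⊆p (∈-L⁺ i∈I v₂∈))) ⟩
  ∣ L[ G ] I ∣               ∎
  where
  open ≤-Reasoning
  R = L[ G ] (I - i)
  v₂∉R∪v₁ : v₂ ∉ R ∪ ⁅ v₁ ⁆
  v₂∉R∪v₁ v₂∈ with x∈p∪q⁻ R ⁅ v₁ ⁆ v₂∈
  ... | inj₁ v₂∈R = v₂∉ v₂∈R
  ... | inj₂ v₂∈⁅v₁⁆ = v₁≢v₂ (sym (x∈⁅y⁆⇒x≡y v₁ v₂∈⁅v₁⁆))
... | no  I-i=∅ rewrite Empty⇒∣p∣≡0 I-i=∅ =
  ≤-trans (≤-reflexive (sym (+-suc d 1))) (≤-trans d+2≤∣Gi∣ (p⊆q⇒∣p∣≤∣q∣ λ x∈ → ∈-L⁺ i∈I x∈))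

-- Two violated sub-masks m₁, m₂ would, by submodularity of L, leave too few points for
-- m₁ ∪ m₂ and m₁ ∩ m₂ together: the intersection contains i and hence both deleted points.
Violation-deleteAt⇒¬Violation-deleteAt : ∀ {d} {G : Fin k → Subset n} {i v₁ v₂ m₁ m₂} → HasSurplus d G m →
  d + 2 ≤ ∣ G i ∣ → v₁ ∈ G i → v₂ ∈ G i → v₁ ≢ v₂ →
  Violation d (deleteAt G i v₁) m m₁ → ¬ Violation d (deleteAt G i v₂) m m₂
Violation-deleteAt⇒¬Violation-deleteAt {m = m} {d} {G} {i} {v₁} {v₂} {m₁} {m₂} surplus d+2≤∣Gi∣ v₁∈ v₂∈ v₁≢v₂ viol₁ viol₂
  with Violation-deleteAt surplus viol₁ | Violation-deleteAt surplus viol₂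
... | tight₁ , i∈m₁ , v₁∉ | tight₂ , i∈m₂ , v₂∉ = n≮n (∣ m₁ ∪ m₂ ∣ + ∣ m₁ ∩ m₂ ∣ + (d + d)) (begin-strict
  ∣ m₁ ∪ m₂ ∣ + ∣ m₁ ∩ m₂ ∣ + (d + d)                 <⟨ ≤-reflexive (1+a+b+[d+d]≡a+d+b+d+1 (∣ m₁ ∪ m₂ ∣) (∣ m₁ ∩ m₂ ∣) d) ⟩
  (∣ m₁ ∪ m₂ ∣ + d) + (∣ m₁ ∩ m₂ ∣ + d + 1)           ≤⟨ +-mono-≤ surplus-∪ surplus-∩ ⟩
  ∣ L[ G ] (m₁ ∪ m₂) ∣ + ∣ L[ G ] (m₁ ∩ m₂) ∣         ≤⟨ L-submodular G m₁ m₂ ⟩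
  ∣ L[ G ] m₁ ∣ + ∣ L[ G ] m₂ ∣                       ≤⟨ +-mono-≤ tight₁ tight₂ ⟩
  (∣ m₁ ∣ + d) + (∣ m₂ ∣ + d)                         ≡⟨ a+d+b+d≡a+b+[d+d] (∣ m₁ ∣) d (∣ m₂ ∣) ⟩
  ∣ m₁ ∣ + ∣ m₂ ∣ + (d + d)                           ≡⟨ cong (_+ (d + d)) (∣p∪q∣+∣p∩q∣≡∣p∣+∣q∣ m₁ m₂) ⟨
  ∣ m₁ ∪ m₂ ∣ + ∣ m₁ ∩ m₂ ∣ + (d + d)                 ∎)
  where
  open ≤-Reasoning
  m₁⊆m = proj₁ viol₁
  m₂⊆m = proj₁ viol₂
  surplus-∪ : ∣ m₁ ∪ m₂ ∣ + d ≤ ∣ L[ G ] (m₁ ∪ m₂) ∣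
  surplus-∪ = surplus (∪-lub m₁⊆m m₂⊆m) (i , p⊆p∪q m₂ i∈m₁)
  surplus-∩ : ∣ m₁ ∩ m₂ ∣ + d + 1 ≤ ∣ L[ G ] (m₁ ∩ m₂) ∣
  surplus-∩ = private-points⇒surplus+1 surplus (⊆-trans (p∩q⊆p m₁ m₂) m₁⊆m) (x∈p∩q⁺ (i∈m₁ , i∈m₂))
    d+2≤∣Gi∣ v₁∈ v₂∈ v₁≢v₂ (v₁∉ ∘ L-mono (∩-i⊆ (p∩q⊆p m₁ m₂))) (v₂∉ ∘ L-mono (∩-i⊆ (p∩q⊆q m₁ m₂)))
    where
    ∩-i⊆ : ∀ {m′} → m₁ ∩ m₂ ⊆ m′ → (m₁ ∩ m₂) - i ⊆ m′ - i
    ∩-i⊆ ⊆m′ j∈ = x∈p∧x≢y⇒x∈p-y (⊆m′ (p─q⊆p _ _ j∈)) (x∈p-y⇒x≢y j∈)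

deletion-step : ∀ {d} {G : Fin k → Subset n} {i} → HasSurplus d G m → d + 2 ≤ ∣ G i ∣ →
                ∃ λ v → v ∈ G i × HasSurplus d (deleteAt G i v) m
deletion-step {m = m} {d} {G} {i} surplus d+2≤∣Gi∣
  with 1<∣p∣⇒distinct (G i) (≤-trans (m≤n+m 2 d) d+2≤∣Gi∣)
... | v₁ , v₂ , v₁∈ , v₂∈ , v₁≢v₂
  with HasSurplus-or-Violation d (deleteAt G i v₁) m | HasSurplus-or-Violation d (deleteAt G i v₂) m
... | inj₁ surplus₁ | _ = v₁ , v₁∈ , surplus₁
... | inj₂ _ | inj₁ surplus₂ = v₂ , v₂∈ , surplus₂
... | inj₂ (_ , viol₁) | inj₂ (_ , viol₂) =
  ⊥-elim (Violation-deleteAt⇒¬Violation-deleteAt surplus d+2≤∣Gi∣ v₁∈ v₂∈ v₁≢v₂ viol₁ viol₂)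

totalSize : (Fin k → Subset n) → ℕ
totalSize {k = zero}  G = 0
totalSize {k = suc k} G = ∣ G zero ∣ + totalSize (G ∘ suc)

totalSize-deleteAt : ∀ (G : Fin k → Subset n) i {v} → v ∈ G i → totalSize (deleteAt G i v) < totalSize G
totalSize-deleteAt G zero    v∈ = +-monoˡ-< (totalSize (G ∘ suc)) (x∈p⇒∣p-x∣<∣p∣ v∈)
totalSize-deleteAt G (suc i) v∈ = +-monoʳ-< ∣ G zero ∣ (totalSize-deleteAt (G ∘ suc) i v∈)

shrink-below : ∀ d fuel (G : Fin k → Subset n) → totalSize G < fuel → HasSurplus d G m →
               ∃ λ P → (∀ j → P j ⊆ G j) × (∀ {j} → j ∈ m → ∣ P j ∣ ≡ d + 1) × HasSurplus d P m
shrink-below d zero G () _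
shrink-below {m = m} d (suc fuel) G size< surplus with any? (λ i → i ∈? m ×-dec d + 2 ≤? ∣ G i ∣)
... | yes (i , _ , d+2≤∣Gi∣) =
  let (v , v∈Gi , surplus′) = deletion-step surplus d+2≤∣Gi∣
      size′< = ≤-trans (totalSize-deleteAt G i v∈Gi) (≤-pred size<)
      (P , P⊆ , ∣P∣≡ , surplusP) = shrink-below d fuel (deleteAt G i v) size′< surplus′
  in P , (λ j → ⊆-trans (P⊆ j) (deleteAt-⊆ G i v j)) , ∣P∣≡ , surplusP
... | no  none = G , (λ _ → ⊆-refl) , exact , surplus
  where
  exact : ∀ {j} → j ∈ m → ∣ G j ∣ ≡ d + 1
  exact {j} j∈m = ≤-antisym
    (≤-pred (≤-trans (≰⇒> λ d+2≤ → none (j , j∈m , d+2≤)) (≤-reflexive (+-suc d 1))))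
    (begin
      d + 1             ≡⟨ +-comm d 1 ⟩
      1 + d             ≡⟨ cong (_+ d) (∣⁅x⁆∣≡1 j) ⟨
      ∣ ⁅ j ⁆ ∣ + d     ≤⟨ surplus (⁅x⁆⊆p j∈m) (j , x∈⁅x⁆ j) ⟩
      ∣ L[ G ] ⁅ j ⁆ ∣  ≤⟨ p⊆q⇒∣p∣≤∣q∣ (L-least λ i∈⁅j⁆ → ⊆-reflexive (cong G (x∈⁅y⁆⇒x≡y j i∈⁅j⁆))) ⟩
      ∣ G j ∣           ∎)
    where open ≤-Reasoning

-- For d = 0 this is Hall's theorem on systems of distinct representatives.
shrink : ∀ d (G : Fin k → Subset n) → HasSurplus d G m →
         ∃ λ P → (∀ j → P j ⊆ G j) × (∀ {j} → j ∈ m → ∣ P j ∣ ≡ d + 1) × HasSurplus d P m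
shrink d G = shrink-below d (suc (totalSize G)) G ≤-refl

-- Rooted trees

Pos? : (t : Tree n) (x : Fin n) → Dec (Pos t x)
Pos? (leaf y) x with y ≟ x
... | yes refl = yes here
... | no  y≢x  = no λ { here → y≢x refl }
Pos? (node cs) x with any? (λ i → Pos? (cs i) x)
... | yes (i , p) = yes (there i p)
... | no  none    = no λ { (there i p) → none (i , p) }

≼-Pos : ∀ {u t : Tree n} → u ≼ t → Pos u x → Pos t x
≼-Pos ≼-refl        p = p
≼-Pos (≼-child i h) p = there i (≼-Pos h p)

≼-trans : ∀ {u v t : Tree n} → u ≼ v → v ≼ t → u ≼ t
≼-trans u≼v ≼-refl        = u≼v
≼-trans u≼v (≼-child i h) = ≼-child i (≼-trans u≼v h)

UniqueLeaves : Tree n → Set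
UniqueLeaves t = ∀ x (p q : Pos t x) → p ≡ q

module _ {k} {cs : Fin (suc (suc k)) → Tree n} (unique : UniqueLeaves (node cs)) where

  UniqueLeaves-child : ∀ i → UniqueLeaves (cs i)
  UniqueLeaves-child i x p q with unique x (there i p) (there i q)
  ... | refl = refl

  Pos-child-unique : ∀ {i j} → Pos (cs i) x → Pos (cs j) x → i ≡ j
  Pos-child-unique {x = x} p q with unique x (there _ p) (there _ q)
  ... | refl = refl

UniqueLeaves-≼ : ∀ {u t : Tree n} → u ≼ t → UniqueLeaves t → UniqueLeaves u
UniqueLeaves-≼ ≼-refl        unique = unique
UniqueLeaves-≼ (≼-child i h) unique = UniqueLeaves-≼ h (UniqueLeaves-child unique i)

≼-comparable : ∀ {T u v : Tree n} → UniqueLeaves T → u ≼ T → v ≼ T → Pos u x → Pos v x → u ≼ v ⊎ v ≼ u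
≼-comparable _      ≼-refl         v≼T            _ _ = inj₂ v≼T
≼-comparable _      (≼-child i u≼) ≼-refl         _ _ = inj₁ (≼-child i u≼)
≼-comparable unique (≼-child i u≼) (≼-child j v≼) p q
  with Pos-child-unique unique (≼-Pos u≼ p) (≼-Pos v≼ q)
... | refl = ≼-comparable (UniqueLeaves-child unique i) u≼ v≼ p q

splitting-vertex : ∀ {a b} (t : Tree n) → Pos t a → Pos t b → a ≢ b → ∃ λ w → w ≼ t × Splits a b w
splitting-vertex (leaf _)  here        here        a≢b = contradiction refl a≢b
splitting-vertex (node cs) (there i p) (there j q) a≢b with i ≟ j
... | no  i≢j  = node cs , ≼-refl , splits i j i≢j p q
... | yes refl = let (w , w≼ , w-splits) = splitting-vertex (cs i) p q a≢b in w , ≼-child i w≼ , w-splits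

≼-node⁻ : ∀ {v : Tree n} {k} {cs : Fin (suc (suc k)) → Tree n} → v ≼ node cs → node cs ≼ v ⊎ ∃ λ i → v ≼ cs i
≼-node⁻ ≼-refl        = inj₁ ≼-refl
≼-node⁻ (≼-child i h) = inj₂ (i , h)

Splits⇒Pos : ∀ {a b} {w : Tree n} → Splits a b w → Pos w a × Pos w b
Splits⇒Pos (splits i j _ p q) = there i p , there j q

record SeparatingVertex (T : Tree n) (S : Subset n) : Set where
  field
    {arity}  : ℕ
    children : Fin (suc (suc arity)) → Tree n
    vertex≼T : node children ≼ T
    covers   : ∀ {z} → z ∈ S → Pos (node children) z
    side     : Fin (suc (suc arity))
    inner    : ∃ λ x → x ∈ S × Pos (children side) x
    outer    : ∃ λ y → y ∈ S × ¬ Pos (children side) y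

separating-vertex : ∀ {S : Subset n} (T : Tree n) → UniqueLeaves T → (∀ {z} → z ∈ S → Pos T z) →
                    x ∈ S → y ∈ S → x ≢ y → SeparatingVertex T S
separating-vertex (leaf _) _ S-in-T x∈S y∈S x≢y with S-in-T x∈S | S-in-T y∈S
... | here | here = contradiction refl x≢y
separating-vertex {x = x} {S = S} (node cs) unique S-in-T x∈S y∈S x≢y with S-in-T x∈S
... | there i x∈cs-i with any? (λ z → z ∈? S ×-dec ¬? (Pos? (cs i) z))
...   | yes (z , z∈S , z∉cs-i) = record
  { children = cs ; vertex≼T = ≼-refl ; covers = S-in-T ; side = i
  ; inner = x , x∈S , x∈cs-i ; outer = z , z∈S , z∉cs-i }
...   | no  none = record
  { children = children ; vertex≼T = ≼-trans vertex≼T (≼-child i ≼-refl) ; covers = covers ; side = side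
  ; inner = inner ; outer = outer }
  where
  open SeparatingVertex (separating-vertex (cs i) (UniqueLeaves-child unique i)
         (λ {z} z∈S → decidable-stable (Pos? (cs i) z) λ z∉ → none (z , z∈S , z∉)) x∈S y∈S x≢y)

module _ {T : Tree n} {S : Subset n} (unique : UniqueLeaves T) (sv : SeparatingVertex T S) where
  open SeparatingVertex sv

  sideColour : Fin n → Bool
  sideColour z = does (Pos? (children side) z)

  private
    unique-vertex : UniqueLeaves (node children)
    unique-vertex = UniqueLeaves-≼ vertex≼T unique

  sideColour-child : ∀ {j a b} → Pos (children j) a → Pos (children j) b → sideColour a ≡ sideColour b
  sideColour-child {j} pa pb = does-⇔ (mk⇔ (move pa pb) (move pb pa)) (Pos? _ _) (Pos? _ _)
    where
    move : ∀ {a b} → Pos (children j) a → Pos (children j) b → Pos (children side) a → Pos (children side) b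
    move pa pb pa′ rewrite Pos-child-unique unique-vertex pa′ pa = pb

  sideColour-Bichromatic : Bichromatic sideColour S
  sideColour-Bichromatic =
    let (x , x∈S , x-in) = inner ; (y , y∈S , y-out) = outer in
    (x , x∈S , dec-true (Pos? _ x) x-in) , (y , y∈S , dec-false (Pos? _ y) y-out)

  private
    below-one-child : ∀ {V a} → V ≼ T → Pos V a → a ∈ S → node children ≼ V ⊎ ∃ λ l → V ≼ children l
    below-one-child V≼T a∈V a∈S with ≼-comparable unique vertex≼T V≼T (covers a∈S) a∈V
    ... | inj₁ vertex≼V = inj₁ vertex≼V
    ... | inj₂ V≼vertex = ≼-node⁻ V≼vertex

  -- The cherry side cs j of a displayed triple inside S cannot contain the separating vertex,
  -- since c would then lie below two children of the root image.
  RootImage-sideColour : ∀ {a b c u} → u ≼ T → RootImage a b c u → a ∈ S → b ∈ S → c ∈ S →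
                         sideColour a ≡ sideColour b
  RootImage-sideColour u≼T (rootImage {cs = cs} i j i≢j c∈cs-i (w , w≼cs-j , w-splits)) a∈S b∈S c∈S
    with Splits⇒Pos w-splits
  ... | a∈w , b∈w with below-one-child (≼-trans (≼-child j ≼-refl) u≼T) (≼-Pos w≼cs-j a∈w) a∈S
  ...   | inj₁ vertex≼cs-j = contradiction
    (Pos-child-unique (UniqueLeaves-≼ u≼T unique) c∈cs-i (≼-Pos vertex≼cs-j (covers c∈S))) i≢j
  ...   | inj₂ (l , cs-j≼l) =
    sideColour-child (≼-Pos cs-j≼l (≼-Pos w≼cs-j a∈w)) (≼-Pos cs-j≼l (≼-Pos w≼cs-j b∈w))

separating-colouring : ∀ {T : Tree n} {S : Subset n} → UniqueLeaves T → (∀ {z} → z ∈ S → Pos T z) →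
  x ∈ S → y ∈ S → x ≢ y →
  ∃ λ col → Bichromatic col S ×
            (∀ {t} → Displays T t → leafSet t ⊆ S → col (RootedTriple.a t) ≡ col (RootedTriple.b t))
separating-colouring {T = T} unique S-in-T x∈S y∈S x≢y =
  sideColour unique sv , sideColour-Bichromatic unique sv ,
  λ { {t} (u , u≼T , image) t⊆S → RootImage-sideColour unique sv u≼T image
        (t⊆S (a∈leafSet t)) (t⊆S (b∈leafSet t)) (t⊆S (c∈leafSet t)) }
  where
  sv = separating-vertex T unique S-in-T x∈S y∈S x≢y

-- Thin families are flexible

Displays-child : ∀ {k} {cs : Fin (suc (suc k)) → Tree n} {t} i → Displays (cs i) t → Displays (node cs) t
Displays-child i (u , u≼ , image) = u , ≼-child i u≼ , image

record TreeOn (t : Fin k → RootedTriple n) (C : Subset n) : Set where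
  field
    tree     : Tree n
    leaves⊆  : ∀ {x} → Pos tree x → x ∈ C
    ⊆leaves  : ∀ {x} → x ∈ C → Pos tree x
    unique   : UniqueLeaves tree
    displays : ∀ {i} → leafSet (t i) ⊆ C → Displays tree (t i)

TreeOn-leaf : ∀ {t : Fin k → RootedTriple n} {C} → ∣ C ∣ ≤ 1 → x ∈ C → TreeOn t C
TreeOn-leaf {x = x} {t = t} {C} ∣C∣≤1 x∈C = record
  { tree = leaf x ; leaves⊆ = λ { here → x∈C } ; ⊆leaves = ⊆leaves ; unique = λ { _ here here → refl }
  ; displays = λ {i} t⊆C → contradiction (∣p∣≤1⇒x≡y ∣C∣≤1 (t⊆C (a∈leafSet (t i))) (t⊆C (b∈leafSet (t i))))
                                          (RootedTriple.a≢b (t i)) }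
  where
  ⊆leaves : ∀ {z} → z ∈ C → Pos (leaf x) z
  ⊆leaves z∈C rewrite ∣p∣≤1⇒x≡y ∣C∣≤1 z∈C x∈C = here

-- A triple inside C whose cherry is monochromatic is displayed inside one colour class or,
-- if c has the other colour, at the new root.
TreeOn-join : ∀ {t : Fin k → RootedTriple n} {C} (col : Fin n → Bool) →
  (∀ {i} → leafSet (t i) ⊆ C → col (RootedTriple.a (t i)) ≡ col (RootedTriple.b (t i))) →
  TreeOn t (C ∩ tabulate col) → TreeOn t (C ∩ ∁ (tabulate col)) → TreeOn t C
TreeOn-join {n = n} {t = t} {C} col respects A B = record
  { tree = node children ; leaves⊆ = leaves⊆ ; ⊆leaves = ⊆leaves ; unique = unique ; displays = displays }
  where
  module A = TreeOn A
  module B = TreeOn B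
  children : Fin 2 → Tree n
  children zero       = A.tree
  children (suc zero) = B.tree
  ∈true : x ∈ C → col x ≡ true → x ∈ C ∩ tabulate col
  ∈true x∈C cx = x∈p∩q⁺ (x∈C , ∈-tabulate⁺ col cx)
  ∈false : x ∈ C → col x ≡ false → x ∈ C ∩ ∁ (tabulate col)
  ∈false x∈C cx = x∈p∩q⁺ (x∈C , ∈-∁tabulate⁺ col cx)
  leaves⊆ : ∀ {x} → Pos (node children) x → x ∈ C
  leaves⊆ (there zero       p) = proj₁ (x∈p∩q⁻ C _ (A.leaves⊆ p))
  leaves⊆ (there (suc zero) p) = proj₁ (x∈p∩q⁻ C _ (B.leaves⊆ p))
  ⊆leaves : ∀ {x} → x ∈ C → Pos (node children) x
  ⊆leaves {x} x∈C with col x in cx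
  ... | true  = there zero       (A.⊆leaves (∈true x∈C cx))
  ... | false = there (suc zero) (B.⊆leaves (∈false x∈C cx))
  disjoint : Pos A.tree x → ¬ Pos B.tree x
  disjoint {x} p q = x∈∁p⇒x∉p (proj₂ (x∈p∩q⁻ C _ (B.leaves⊆ q))) (proj₂ (x∈p∩q⁻ C _ (A.leaves⊆ p)))
  unique : UniqueLeaves (node children)
  unique x (there zero       p) (there zero       q) = cong (there zero) (A.unique x p q)
  unique x (there (suc zero) p) (there (suc zero) q) = cong (there (suc zero)) (B.unique x p q)
  unique x (there zero       p) (there (suc zero) q) = ⊥-elim (disjoint p q)
  unique x (there (suc zero) p) (there zero       q) = ⊥-elim (disjoint q p)
  displays : ∀ {i} → leafSet (t i) ⊆ C → Displays (node children) (t i)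
  displays {i} t⊆C = by-colours (col a) refl (col c) refl
    where
    open RootedTriple (t i)
    a∈C = t⊆C (a∈leafSet (t i))
    b∈C = t⊆C (b∈leafSet (t i))
    c∈C = t⊆C (c∈leafSet (t i))
    cb≡ca : col b ≡ col a
    cb≡ca = sym (respects t⊆C)
    by-colours : ∀ ca → col a ≡ ca → ∀ cc → col c ≡ cc → Displays (node children) (t i)
    by-colours true  ca true  cc = Displays-child {cs = children} {t = t i} zero
      (A.displays (leafSet⊆ (t i) (∈true a∈C ca) (∈true b∈C (trans cb≡ca ca)) (∈true c∈C cc)))
    by-colours false ca false cc = Displays-child {cs = children} {t = t i} (suc zero)
      (B.displays (leafSet⊆ (t i) (∈false a∈C ca) (∈false b∈C (trans cb≡ca ca)) (∈false c∈C cc)))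
    by-colours true  ca false cc = node children , ≼-refl , rootImage (suc zero) zero (λ ())
      (B.⊆leaves (∈false c∈C cc))
      (splitting-vertex A.tree (A.⊆leaves (∈true a∈C ca)) (A.⊆leaves (∈true b∈C (trans cb≡ca ca))) a≢b)
    by-colours false ca true  cc = node children , ≼-refl , rootImage zero (suc zero) (λ ())
      (A.⊆leaves (∈true c∈C cc))
      (splitting-vertex B.tree (B.⊆leaves (∈false a∈C ca)) (B.⊆leaves (∈false b∈C (trans cb≡ca ca))) a≢b)

module _ (t : Fin k → RootedTriple n) (thin : HasSurplus 2 (leafSet ∘ t) ⊤) where

  triplesIn : Subset n → Subset k
  triplesIn C = tabulate λ i → does (leafSet (t i) ⊆? C)

  triplesIn⊆ : ∀ {C i} → i ∈ triplesIn C → leafSet (t i) ⊆ C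
  triplesIn⊆ {C} {i} i∈ with leafSet (t i) ⊆? C | ∈-tabulate⁻ (λ j → does (leafSet (t j) ⊆? C)) i∈
  ... | yes t⊆C | _ = t⊆C

  ⊆triplesIn : ∀ {C i} → leafSet (t i) ⊆ C → i ∈ triplesIn C
  ⊆triplesIn {C} {i} t⊆C = ∈-tabulate⁺ _ (dec-true (leafSet (t i) ⊆? C) t⊆C)

  -- Thinness leaves room for the contraction colouring of the cherries of the triples inside C.
  treeOn : ∀ fuel C → ∣ C ∣ ≤ fuel → Nonempty C → TreeOn t C
  treeOn zero       C ∣C∣≤0 (x , x∈C) = contradiction ∣C∣≤0 (<⇒≱ (x∈p⇒0<∣p∣ x∈C))
  treeOn (suc fuel) C ∣C∣≤  (x , x∈C) with 2 ≤? ∣ C ∣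
  ... | no  ∣C∣≱2 = TreeOn-leaf (≤-pred (≰⇒> ∣C∣≱2)) x∈C
  ... | yes ∣C∣≥2
    with contraction-colouring (RootedTriple.a ∘ t) (RootedTriple.b ∘ t) (triplesIn C) C
           (HasSurplus-part {m′ = triplesIn C} thin ⊆⊤ (L-least (triplesIn⊆ {C})) ∣C∣≥2)
  ...   | col , respects , (y , y∈C , cy) , (z , z∈C , cz) = TreeOn-join col (respects ∘ ⊆triplesIn)
    (treeOn fuel (C ∩ tabulate col) (≤-pred (≤-trans (∣p∩q∣<∣p∣ C _ (z , z∈false)) ∣C∣≤)) (y , y∈true))
    (treeOn fuel (C ∩ ∁ (tabulate col)) (≤-pred (≤-trans (∣p∩∁q∣<∣p∣ C _ (y , y∈true)) ∣C∣≤)) (z , z∈false))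
    where
    y∈true = x∈p∩q⁺ (y∈C , ∈-tabulate⁺ col cy)
    z∈false = x∈p∩q⁺ (z∈C , ∈-∁tabulate⁺ col cz)

  HasSurplus₂⇒compatible : Fin n → ∃ λ T → IsXTree T × ∀ i → Displays T (t i)
  HasSurplus₂⇒compatible x = tree , (λ y → ⊆leaves ∈⊤ , unique y) , λ i → displays ⊆⊤
    where open TreeOn (treeOn n ⊤ (≤-reflexive (∣⊤∣≡n n)) (x , ∈⊤))

FlexibleFamily : (Fin k → Subset n) → Set
FlexibleFamily {k} {n} F = (t : (i : Fin k) → Σ (RootedTriple n) λ t → leafSet t ≡ F i) →
                           ∃ λ T → IsXTree T × ∀ i → Displays T (proj₁ (t i))

HasSurplus₂⇒FlexibleFamily : ∀ {F : Fin k → Subset n} → HasSurplus 2 F ⊤ → Fin n → FlexibleFamily F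
HasSurplus₂⇒FlexibleFamily thin x t =
  HasSurplus₂⇒compatible (proj₁ ∘ t) (HasSurplus-mono (λ {i} _ → ⊆-reflexive (sym (proj₂ (t i)))) thin) x

-- Flexible families are thin

cherry : RootedTriple n → Subset n
cherry t = ⁅ RootedTriple.a t ⁆ ∪ ⁅ RootedTriple.b t ⁆

triple-with-cherry : ∀ {s : Subset n} {a b} → ∣ s ∣ ≡ 3 → a ∈ s → b ∈ s → a ≢ b →
                     Σ (RootedTriple n) λ t → leafSet t ≡ s × cherry t ≡ ⁅ a ⁆ ∪ ⁅ b ⁆
triple-with-cherry {a = a} {b} ∣s∣≡3 a∈s b∈s a≢b =
  let (c , a≢c , b≢c , ≡s) = third-element a∈s b∈s a≢b ∣s∣≡3 in
  record { a = a ; b = b ; c = c ; a≢b = a≢b ; a≢c = a≢c ; b≢c = b≢c } , ≡s , refl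

triples-with-cherries : ∀ {F P : Fin k → Subset n} {m} → (∀ i → ∣ F i ∣ ≡ 3) → (∀ i → P i ⊆ F i) →
  (∀ {i} → i ∈ m → ∣ P i ∣ ≡ 2) →
  Σ ((i : Fin k) → Σ (RootedTriple n) λ t → leafSet t ≡ F i) λ t → ∀ {i} → i ∈ m → P i ⊆ cherry (proj₁ (t i))
triples-with-cherries {n = n} {F = F} {P} {m} ∣F∣≡3 P⊆F ∣P∣≡2 =
  (λ i → proj₁ (tripleAt i) , proj₁ (proj₂ (tripleAt i))) ,
  λ {i} i∈m → ⊆-reflexive (proj₂ (proj₂ (tripleAt i)) i∈m)
  where
  tripleAt : ∀ i → Σ (RootedTriple n) λ t → leafSet t ≡ F i × (i ∈ m → P i ≡ cherry t)
  tripleAt i with i ∈? m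
  ... | yes i∈m =
    let (a , b , a∈ , b∈ , a≢b) = 1<∣p∣⇒distinct (P i) (≤-reflexive (sym (∣P∣≡2 i∈m)))
        (t , t≡Fi , cherry≡) = triple-with-cherry (∣F∣≡3 i) (P⊆F i a∈) (P⊆F i b∈) a≢b
    in t , t≡Fi , λ i∈m → trans (x∈p⇒y∈p⇒∣p∣≡2⇒p≡⁅x⁆∪⁅y⁆ a∈ b∈ a≢b (∣P∣≡2 i∈m)) (sym cherry≡)
  ... | no  i∉m =
    let (a , b , a∈ , b∈ , a≢b) = 1<∣p∣⇒distinct (F i) (≤-trans (s≤s (s≤s z≤n)) (≤-reflexive (sym (∣F∣≡3 i))))
        (t , t≡Fi , _) = triple-with-cherry (∣F∣≡3 i) a∈ b∈ a≢b
    in t , t≡Fi , λ i∈m → contradiction i∈m i∉m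

cherry⊆leafSet : (t : RootedTriple n) → cherry t ⊆ leafSet t
cherry⊆leafSet t = ∪-lub (⁅x⁆⊆p (a∈leafSet t)) (⁅x⁆⊆p (b∈leafSet t))

-- Colour by a vertex of T separating L(m): every displayed cherry is monochromatic.
displayed-cherries-bound : ∀ {t : Fin k → RootedTriple n} {m} {T : Tree n} → IsXTree T →
  (∀ i → Displays T (t i)) → HasSurplus 1 (cherry ∘ t) m → Nonempty m → ∣ m ∣ + 2 ≤ ∣ L[ leafSet ∘ t ] m ∣
displayed-cherries-bound {t = t} {m} isX displays surplus (i₀ , i₀∈m)
  with separating-colouring (λ x → proj₂ (isX x)) (λ {z} _ → proj₁ (isX z))
         (∈-L⁺ {F = leafSet ∘ t} i₀∈m (a∈leafSet (t i₀))) (∈-L⁺ {F = leafSet ∘ t} i₀∈m (b∈leafSet (t i₀)))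
         (RootedTriple.a≢b (t i₀))
... | col , bichromatic , sameSide =
  HasSurplus₁-monochromatic {col = col} {E₁ = RootedTriple.a ∘ t} {E₂ = RootedTriple.b ∘ t}
    surplus (λ {i} i∈m → sameSide {t i} (displays i) (∈-L⁺ {F = leafSet ∘ t} i∈m))
    (L-least {m = m} λ {i} i∈m → ⊆-trans (cherry⊆leafSet (t i)) (∈-L⁺ {F = leafSet ∘ t} i∈m)) bichromatic

flexible-surplus₁-bound : ∀ {F : Fin k → Subset n} {m} → (∀ i → ∣ F i ∣ ≡ 3) → FlexibleFamily F →
  HasSurplus 1 F m → Nonempty m → ∣ m ∣ + 2 ≤ ∣ L[ F ] m ∣
flexible-surplus₁-bound {F = F} {m} ∣F∣≡3 flexible surplus m≠∅ =
  let (P , P⊆F , ∣P∣≡2 , surplusP) = shrink {m = m} 1 F surplus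
      (t , P⊆cherry) = triples-with-cherries {F = F} {P} {m} ∣F∣≡3 P⊆F ∣P∣≡2
      (T , isX , displays) = flexible t
  in subst (λ L → ∣ m ∣ + 2 ≤ ∣ L ∣) (L-cong {F = leafSet ∘ proj₁ ∘ t} {F} {m} λ i → proj₂ (t i))
       (displayed-cherries-bound {t = proj₁ ∘ t} {m} isX displays
         (HasSurplus-mono {F = P} P⊆cherry surplusP) m≠∅)

FlexibleFamily⇒HasSurplus₂ : ∀ {F : Fin k → Subset n} → (∀ i → ∣ F i ∣ ≡ 3) → FlexibleFamily F →
                             HasSurplus 2 F ⊤
FlexibleFamily⇒HasSurplus₂ {F = F} ∣F∣≡3 flexible {m} _ = bounded (suc ∣ m ∣) ≤-refl
  where
  bounded : ∀ fuel {m} → ∣ m ∣ < fuel → Nonempty m → ∣ m ∣ + 2 ≤ ∣ L[ F ] m ∣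
  bounded (suc fuel) ∣m∣<fuel m≠∅ = flexible-surplus₁-bound ∣F∣≡3 flexible
    (HasSurplus-from-smaller (λ {i} _ → ≤-trans (s≤s (s≤s z≤n)) (≤-reflexive (sym (∣F∣≡3 i))))
                             (λ ∣m′∣<∣m∣ → bounded fuel (≤-trans ∣m′∣<∣m∣ (≤-pred ∣m∣<fuel))))
    m≠∅

FlexibleFamily⇔HasSurplus₂ : ∀ {F : Fin k → Subset n} → (∀ i → ∣ F i ∣ ≡ 3) → Fin n →
                             FlexibleFamily F ⇔ HasSurplus 2 F ⊤
FlexibleFamily⇔HasSurplus₂ ∣F∣≡3 x = mk⇔ (FlexibleFamily⇒HasSurplus₂ ∣F∣≡3) λ thin → HasSurplus₂⇒FlexibleFamily thin x

choiceAt : ∀ {τ : List (Subset n)} → Choice τ → (i : Fin (length τ)) → Σ (RootedTriple n) λ t → leafSet t ≡ lookup τ i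
choiceAt (choice ∷ _)       zero    = choice
choiceAt (_      ∷ choices) (suc i) = choiceAt choices i

tabulateChoice : ∀ (τ : List (Subset n)) → ((i : Fin (length τ)) → Σ (RootedTriple n) λ t → leafSet t ≡ lookup τ i) →
                 Choice τ
tabulateChoice []      t = []
tabulateChoice (_ ∷ τ) t = t zero ∷ tabulateChoice τ (t ∘ suc)

All-chosen⁺ : ∀ {P : RootedTriple n → Set} {τ : List (Subset n)} (ch : Choice τ) →
              (∀ i → P (proj₁ (choiceAt ch i))) → All P (chosen ch)
All-chosen⁺ []       _ = []
All-chosen⁺ (_ ∷ ch) P-at = P-at zero ∷ All-chosen⁺ ch (P-at ∘ suc)

All-chosen-tabulate⁻ : ∀ {P : RootedTriple n → Set} (τ : List (Subset n)) t →
                       All P (chosen (tabulateChoice τ t)) → ∀ i → P (proj₁ (t i))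
All-chosen-tabulate⁻ (_ ∷ τ) t (p ∷ _)  zero    = p
All-chosen-tabulate⁻ (_ ∷ τ) t (_ ∷ ps) (suc i) = All-chosen-tabulate⁻ τ (t ∘ suc) ps i

PhylogeneticallyFlexible⇔FlexibleFamily : (τ : List (Subset n)) → PhylogeneticallyFlexible τ ⇔ FlexibleFamily (lookup τ)
PhylogeneticallyFlexible⇔FlexibleFamily τ = mk⇔ to from
  where
  to : PhylogeneticallyFlexible τ → FlexibleFamily (lookup τ)
  to flexible t with flexible (tabulateChoice τ t)
  ... | T , isX , displays = T , isX , All-chosen-tabulate⁻ τ t displays
  from : FlexibleFamily (lookup τ) → PhylogeneticallyFlexible τ
  from flexible ch with flexible (choiceAt ch)
  ... | T , isX , displays = T , isX , All-chosen⁺ ch displays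

inhabitant : (τ : List (Subset n)) → τ ≢ [] → All (λ s → ∣ s ∣ ≡ 3) τ → Fin n
inhabitant []      τ≢[] _             = contradiction refl τ≢[]
inhabitant (s ∷ _) _    (∣s∣≡3 ∷ _) = proj₁ (0<∣p∣⇒Nonempty s (≤-trans (s≤s z≤n) (≤-reflexive (sym ∣s∣≡3))))

theorem1 : (n : ℕ) (τ : Collection3 n) → Collection3.sets τ ≢ [] →
    PhylogeneticallyFlexible (Collection3.sets τ) ⇔ Thin (Collection3.sets τ)
theorem1 n τ sets≢[] =
  ⇔.trans (PhylogeneticallyFlexible⇔FlexibleFamily sets)
  (⇔.trans (FlexibleFamily⇔HasSurplus₂ (λ i → All.lookup allSize (∈-lookup i)) (inhabitant sets sets≢[] allSize))
           (⇔.sym (Thin⇔HasSurplus₂ sets)))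
  where open Collection3 τ
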